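{- Let $n\geq 3$ and let $p=p_1p_2\cdots p_n$ range over the permutations of $\{1,\dots,n\}$. For each $i$ with $1\leq i\leq n-2$, the number of such permutations $p$ for which $p_i$ is a leaf of the minmax tree $T^m_p$ is $n!/3$. Moreover, $p_{n-1}$ is never a leaf of $T^m_p$, and $p_n$ is always a leaf of $T^m_p$.
   Context: For a word $w$ of distinct integers, its minmax tree $T^m_w$ is the binary tree defined recursively: if $w$ is empty the tree is empty; otherwise write $w=u\,m\,v$ where $m$ is the leftmost of the two letters of $w$ that are its minimum and its maximum (i.e. whichever of $\min w$, $\max w$ occurs first), $u$ is the subword before $m$ and $v$ the subword after $m$. Then $T^m_w$ has root $m$, left subtree $T^m_u$ and right subtree $T^m_v$. For a permutation $p$ of length $n$, the nodes of $T^m_p$ are the entries $p_1,\dots,p_n$; $p_i$ is a leaf if both its left and right subtrees are empty. -}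

module Defs where

open import Data.Nat using (ℕ; zero; suc; _≤_; _⊓_; _⊔_; _≡ᵇ_; _∸_)
open import Data.Nat.Properties using (_≟_; _≤?_)
open import Data.Bool using (Bool; true; false; _∨_; _∧_; if_then_else_)
open import Data.List using (List; []; _∷_; length; map; concatMap; filter; applyUpTo)
open import Data.List.Relation.Unary.All using (All; all?)
open import Data.List.Relation.Unary.Unique.Propositional using (Unique)
open import Data.List.Relation.Unary.Unique.DecPropositional _≟_ using (unique?)
open import Data.Product using (_×_; _,_)
open import Relation.Binary.PropositionalEquality using (_≡_)
open import Relation.Nullary using (Dec)
open import Relation.Nullary.Decidable using (_×-dec_)
open import Data.Maybe using (Maybe; just; nothing)

data Tree : Set where
  empty : Tree
  node  : Tree → ℕ → Tree → Tree

minW : ℕ → List ℕ → ℕ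
minW x []       = x
minW x (y ∷ ys) = x ⊓ minW y ys

maxW : ℕ → List ℕ → ℕ
maxW x []       = x
maxW x (y ∷ ys) = x ⊔ maxW y ys

-- Splits w = u m v at the leftmost letter m that equals a or b
-- (returns u, m, v); used with a = min w and b = max w.
record Split : Set where
  constructor split
  field
    before : List ℕ
    letter : ℕ
    after  : List ℕ

splitAt₂ : ℕ → ℕ → ℕ → List ℕ → Split
splitAt₂ a b x xs with (x ≡ᵇ a) ∨ (x ≡ᵇ b)
splitAt₂ a b x xs       | true  = split [] x xs
splitAt₂ a b x []       | false = split [] x []   -- unreachable when a or b occurs
splitAt₂ a b x (y ∷ ys) | false with splitAt₂ a b y ys
... | split u m v = split (x ∷ u) m v

-- minmax tree with fuel; the fuel argument is the length of the word,
-- which always suffices since u and v are strictly shorter than w.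
minmaxF : ℕ → List ℕ → Tree
minmaxF _       []       = empty
minmaxF zero    (_ ∷ _)  = empty   -- unreachable with enough fuel
minmaxF (suc k) (x ∷ xs) with splitAt₂ (minW x xs) (maxW x xs) x xs
... | split u m v = node (minmaxF k u) m (minmaxF k v)

minmaxTree : List ℕ → Tree
minmaxTree w = minmaxF (length w) w

-- is the node labelled x a leaf of the tree (labels are distinct)?
isLeafLabel : ℕ → Tree → Bool
isLeafLabel x empty = false
isLeafLabel x (node l y r) with x ≡ᵇ y
isLeafLabel x (node empty y empty) | true = true
isLeafLabel x (node l y r)         | true = false
isLeafLabel x (node l y r)         | false = isLeafLabel x l ∨ isLeafLabel x r

-- 1-based entry p_i of a word
entry : List ℕ → ℕ → Maybe ℕ
entry []       _             = nothing
entry (x ∷ xs) zero          = nothing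
entry (x ∷ xs) (suc zero)    = just x
entry (x ∷ xs) (suc (suc i)) = entry xs (suc i)

isLeafAt : List ℕ → ℕ → Bool
isLeafAt p i with entry p i
... | just x  = isLeafLabel x (minmaxTree p)
... | nothing = false

IsPerm : ℕ → List ℕ → Set
IsPerm n w = length w ≡ n × All (λ x → 1 ≤ x × x ≤ n) w × Unique w

isPerm? : ∀ n w → Dec (IsPerm n w)
isPerm? n w = (length w ≟ n) ×-dec (all? (λ x → (1 ≤? x) ×-dec (x ≤? n)) w ×-dec unique? w)

words : ℕ → ℕ → List (List ℕ)
words n zero    = [] ∷ []
words n (suc k) = concatMap (λ x → map (x ∷_) (words n k)) (applyUpTo suc n)

perms : ℕ → List (List ℕ)
perms n = filter (isPerm? n) (words n n)

{-# OPTIONS --safe #-}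
module Submission where

-- Fix three consecutive entries a b c and follow the recursion to the first subword whose root
-- is one of them. Before that point the recursion never looks at the order of a, b, c, so the three
-- cyclic rotations of the block reach the same subword, with the same extremes. There the first entry
-- x of the block (followed by y) is a leaf iff x is not extreme but y is: if x is the root its right
-- subtree is nonempty; if y is, x is the last letter of the left part, and a last letter is always a
-- leaf; otherwise x is second-to-last in the left part, and a second-to-last letter never is (were it
-- not extreme, both extremes would be the last letter). As one or two of three distinct letters are
-- extreme, exactly one rotation makes x a leaf. Rotating a block permutes the permutations of
-- {1,…,n}, so each rotation contributes the same count, namely n!/3.

open import Defs
open import Data.Bool using (Bool; true; false; not; _∧_; _∨_)
open import Data.Bool.Properties using (T-≡; T-∨; ∨-zeroʳ; ∨-identityʳ)
open import Data.Empty using (⊥)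
open import Data.List
  using (List; []; _∷_; _++_; _∷ʳ_; initLast; _∷ʳ′_; length; map; filter; filterᵇ; concatMap; applyUpTo;
         cartesianProductWith)
open import Data.List.Properties
  using (++-assoc; ++-conicalˡ; ++-conicalʳ; length-++; length-++-sucʳ; length-map; length-applyUpTo;
         ∷-injective; ∷-injectiveʳ; filter-++; filter-accept; filter-reject; filter-all)
open import Data.List.Membership.Propositional using (_∈_; _∉_)
open import Data.List.Membership.Propositional.Properties
  using (∈-++⁺ˡ; ∈-++⁺ʳ; ∈-++⁻; ∈-map⁺; ∈-map⁻; ∈-filter⁺; ∈-filter⁻; ∈-applyUpTo⁺; ∈-applyUpTo⁻;
         ∈-cartesianProductWith⁺; ∈-cartesianProductWith⁻)
open import Data.List.Membership.Propositional.Properties.WithK using (unique∧set⇒bag)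
open import Data.List.Relation.Binary.BagAndSetEquality using (∼bag⇒↭)
open import Data.List.Relation.Binary.Disjoint.Propositional using (Disjoint)
open import Data.List.Relation.Binary.Permutation.Propositional
  using (_↭_; ↭-refl; ↭-sym; ↭-trans; ↭-prep; ↭-swap; ↭⇒↭ₛ)
open import Data.List.Relation.Binary.Permutation.Propositional.Properties
  using (↭-length; ∈-resp-↭; All-resp-↭; Any-resp-↭; ++⁺ˡ; ++⁺ʳ; filter-↭)
import Data.List.Relation.Binary.Permutation.Setoid.Properties as ↭ₛ
open import Data.List.Relation.Unary.All as All using (All; []; _∷_)
import Data.List.Relation.Unary.All.Properties as All
open import Data.List.Relation.Unary.Any as Any using (Any; here; there)
import Data.List.Relation.Unary.Any.Properties as Any
open import Data.List.Relation.Unary.Unique.Propositional using (Unique; []; _∷_)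
import Data.List.Relation.Unary.Unique.Propositional.Properties as Unique
open import Data.Maybe using (just)
open import Data.Nat using (ℕ; zero; suc; _+_; _*_; _∸_; _/_; _!; _≡ᵇ_; _≤_; s≤s; z≤n)
open import Data.Nat.DivMod using (m*n/n≡m)
open import Data.Nat.Properties
  using (_≟_; ≤-refl; ≤-trans; ≤-antisym; ≤-pred; ⊓-sel; ⊔-sel; m⊓n≤m; m⊓n≤n; m≤m⊔n; m≤n⊔m;
         m+n≤o⇒m≤o; m+n≤o⇒n≤o; ≡ᵇ⇒≡; +-suc; +-comm; suc-injective; <⇒≢)
open import Data.Nat.Solver using (module +-*-Solver)
open import Data.List.Relation.Unary.Unique.DecPropositional _≟_ using (unique?)
open import Data.Product as Product using (_×_; _,_; proj₁; proj₂)
open import Data.Sum as Sum using (_⊎_; inj₁; inj₂)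
open import Function using (id; _∘_; Equivalence; _⇔_; mk⇔)
open import Function.Properties.Equivalence using () renaming (trans to ⇔-trans)
open import Relation.Binary.PropositionalEquality
  using (_≡_; _≢_; refl; sym; trans; cong; cong₂; subst; setoid; module ≡-Reasoning)
open import Relation.Nullary using (¬_; contradiction)
open import Relation.Nullary.Decidable using (¬?; T?; dec-true; dec-false)

minOf maxOf : List ℕ → ℕ
minOf []       = 0
minOf (x ∷ xs) = minW x xs
maxOf []       = 0
maxOf (x ∷ xs) = maxW x xs

minW-∈ : ∀ x xs → minW x xs ∈ x ∷ xs
minW-∈ x []       = here refl
minW-∈ x (y ∷ ys) with ⊓-sel x (minW y ys)
... | inj₁ x⊓m≡x = here x⊓m≡x
... | inj₂ x⊓m≡m = there (subst (_∈ y ∷ ys) (sym x⊓m≡m) (minW-∈ y ys))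

maxW-∈ : ∀ x xs → maxW x xs ∈ x ∷ xs
maxW-∈ x []       = here refl
maxW-∈ x (y ∷ ys) with ⊔-sel x (maxW y ys)
... | inj₁ x⊔m≡x = here x⊔m≡x
... | inj₂ x⊔m≡m = there (subst (_∈ y ∷ ys) (sym x⊔m≡m) (maxW-∈ y ys))

minW-≤ : ∀ x xs {z} → z ∈ x ∷ xs → minW x xs ≤ z
minW-≤ x []       (here refl) = ≤-refl
minW-≤ x (y ∷ ys) (here refl) = m⊓n≤m x _
minW-≤ x (y ∷ ys) (there z∈)  = ≤-trans (m⊓n≤n x _) (minW-≤ y ys z∈)

maxW-≥ : ∀ x xs {z} → z ∈ x ∷ xs → z ≤ maxW x xs
maxW-≥ x []       (here refl) = ≤-refl
maxW-≥ x (y ∷ ys) (here refl) = m≤m⊔n x _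
maxW-≥ x (y ∷ ys) (there z∈)  = ≤-trans (maxW-≥ y ys z∈) (m≤n⊔m x _)

minOf-resp-↭ : ∀ {w w′} → w ↭ w′ → minOf w ≡ minOf w′
minOf-resp-↭ {[]}     {[]}     _ = refl
minOf-resp-↭ {[]}     {_ ∷ _}  σ = contradiction (↭-length σ) λ ()
minOf-resp-↭ {_ ∷ _}  {[]}     σ = contradiction (↭-length σ) λ ()
minOf-resp-↭ {x ∷ xs} {y ∷ ys} σ = ≤-antisym
  (minW-≤ x xs (∈-resp-↭ (↭-sym σ) (minW-∈ y ys)))
  (minW-≤ y ys (∈-resp-↭ σ (minW-∈ x xs)))

maxOf-resp-↭ : ∀ {w w′} → w ↭ w′ → maxOf w ≡ maxOf w′
maxOf-resp-↭ {[]}     {[]}     _ = refl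
maxOf-resp-↭ {[]}     {_ ∷ _}  σ = contradiction (↭-length σ) λ ()
maxOf-resp-↭ {_ ∷ _}  {[]}     σ = contradiction (↭-length σ) λ ()
maxOf-resp-↭ {x ∷ xs} {y ∷ ys} σ = ≤-antisym
  (maxW-≥ y ys (∈-resp-↭ σ (maxW-∈ x xs)))
  (maxW-≥ x xs (∈-resp-↭ (↭-sym σ) (maxW-∈ y ys)))

-- Literally the test splitAt₂ applies, so isExtreme (x ∷ xs) agrees with minmaxF's choice of root by definition.
isOneOf : ℕ → ℕ → ℕ → Bool
isOneOf a b x = (x ≡ᵇ a) ∨ (x ≡ᵇ b)

isExtreme : List ℕ → ℕ → Bool
isExtreme w = isOneOf (minOf w) (maxOf w)

NonExtreme : List ℕ → List ℕ → Set
NonExtreme w = All (λ q → isExtreme w q ≡ false)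

isExtreme-resp-↭ : ∀ {w w′} → w ↭ w′ → ∀ x → isExtreme w x ≡ isExtreme w′ x
isExtreme-resp-↭ σ x = cong₂ (λ a b → isOneOf a b x) (minOf-resp-↭ σ) (maxOf-resp-↭ σ)

isExtreme-minOf : ∀ w → isExtreme w (minOf w) ≡ true
isExtreme-minOf w rewrite dec-true (minOf w ≟ minOf w) refl = refl

isExtreme-maxOf : ∀ w → isExtreme w (maxOf w) ≡ true
isExtreme-maxOf w rewrite dec-true (maxOf w ≟ maxOf w) refl = ∨-zeroʳ _

isExtreme⇒ : ∀ w x → isExtreme w x ≡ true → x ≡ minOf w ⊎ x ≡ maxOf w
isExtreme⇒ w x e =
  Sum.map (≡ᵇ⇒≡ x (minOf w)) (≡ᵇ⇒≡ x (maxOf w)) (Equivalence.to T-∨ (Equivalence.from T-≡ e))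

isExtreme-≡minOf : ∀ w {x} → x ≡ minOf w → isExtreme w x ≡ true
isExtreme-≡minOf w refl = isExtreme-minOf w

isExtreme⇒∉ : ∀ {w Q x} → NonExtreme w Q → isExtreme w x ≡ true → x ∉ Q
isExtreme⇒∉ nQ e x∈Q = contradiction (trans (sym e) (All.lookup nQ x∈Q)) λ ()

nonExtreme⇒[] : ∀ {w} → NonExtreme w w → w ≡ []
nonExtreme⇒[] {[]}     _  = refl
nonExtreme⇒[] {x ∷ xs} nw = contradiction (minW-∈ x xs) (isExtreme⇒∉ {x ∷ xs} nw (isExtreme-minOf (x ∷ xs)))

-- Both extremes then lie in the last position, so they coincide and pin every letter.
nonExtreme-init⇒[] : ∀ {w} Q z → w ≡ Q ++ z ∷ [] → NonExtreme w Q → Q ≡ []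
nonExtreme-init⇒[] []      z _    _  = refl
nonExtreme-init⇒[] (q ∷ Q) z refl nQ =
  contradiction (here refl) (isExtreme⇒∉ {w} nQ (isExtreme-≡minOf w q≡min))
  where
  w = q ∷ Q ++ z ∷ []
  atLast : ∀ {x} → x ∈ w → isExtreme w x ≡ true → x ≡ z
  atLast x∈w e with ∈-++⁻ (q ∷ Q) x∈w
  ... | inj₁ x∈Q        = contradiction x∈Q (isExtreme⇒∉ {w} nQ e)
  ... | inj₂ (here x≡z) = x≡z
  min≡max : minOf w ≡ maxOf w
  min≡max = trans (atLast (minW-∈ q (Q ++ z ∷ [])) (isExtreme-minOf w))
                  (sym (atLast (maxW-∈ q (Q ++ z ∷ [])) (isExtreme-maxOf w)))
  q≡min : q ≡ minOf w
  q≡min = ≤-antisym (subst (q ≤_) (sym min≡max) (maxW-≥ q (Q ++ z ∷ []) (here refl)))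
                    (minW-≤ q (Q ++ z ∷ []) (here refl))

module _ {A : Set} (f : A → Bool) where

  data FirstHit (w : List A) : Set where
    hit  : ∀ Q m R → w ≡ Q ++ m ∷ R → All (λ q → f q ≡ false) Q → f m ≡ true → FirstHit w
    none : All (λ q → f q ≡ false) w → FirstHit w

  firstHit : ∀ w → FirstHit w
  firstHit []       = none []
  firstHit (x ∷ xs) with f x in fx | firstHit xs
  ... | true  | _                      = hit [] x xs refl [] fx
  ... | false | hit Q m R refl fQ fm   = hit (x ∷ Q) m R refl (fx ∷ fQ) fm
  ... | false | none fxs               = none (fx ∷ fxs)

record RootSplit (w Q : List ℕ) (m : ℕ) (R : List ℕ) : Set where
  constructor rootSplit
  field
    split-≡      : w ≡ Q ++ m ∷ R
    nonExtremeˡ  : NonExtreme w Q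
    root-extreme : isExtreme w m ≡ true

consBefore : ℕ → Split → Split
consBefore x (split u m v) = split (x ∷ u) m v

splitAt₂-hit : ∀ {a b x} xs → isOneOf a b x ≡ true → splitAt₂ a b x xs ≡ split [] x xs
splitAt₂-hit xs hx rewrite hx = refl

splitAt₂-skip : ∀ {a b x} Q m R → isOneOf a b x ≡ false →
                All (λ q → isOneOf a b q ≡ false) Q → isOneOf a b m ≡ true →
                splitAt₂ a b x (Q ++ m ∷ R) ≡ split (x ∷ Q) m R
splitAt₂-skip {x = x} []      m R hx _         hm rewrite hx = cong (consBefore x) (splitAt₂-hit R hm)
splitAt₂-skip {x = x} (q ∷ Q) m R hx (hq ∷ hQ) hm rewrite hx = cong (consBefore x) (splitAt₂-skip Q m R hq hQ hm)

nodeOf : ℕ → Split → Tree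
nodeOf k (split u m v) = node (minmaxF k u) m (minmaxF k v)

minmaxF-root : ∀ k {w Q m R} → RootSplit w Q m R → minmaxF (suc k) w ≡ node (minmaxF k Q) m (minmaxF k R)
minmaxF-root k {Q = []}    {m} {R} (rootSplit refl _ hm)         = cong (nodeOf k) (splitAt₂-hit R hm)
minmaxF-root k {Q = q ∷ Q} {m} {R} (rootSplit refl (hq ∷ hQ) hm) = cong (nodeOf k) (splitAt₂-skip Q m R hq hQ hm)

-- Leaves

isLeafLabel-node-≢ : ∀ {x y} l r → x ≢ y → isLeafLabel x (node l y r) ≡ isLeafLabel x l ∨ isLeafLabel x r
isLeafLabel-node-≢ {x} {y} empty        empty        x≢y rewrite dec-false (x ≟ y) x≢y = refl
isLeafLabel-node-≢ {x} {y} empty        (node _ _ _) x≢y rewrite dec-false (x ≟ y) x≢y = refl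
isLeafLabel-node-≢ {x} {y} (node _ _ _) _            x≢y rewrite dec-false (x ≟ y) x≢y = refl

isLeafLabel-singleton : ∀ x → isLeafLabel x (node empty x empty) ≡ true
isLeafLabel-singleton x rewrite dec-true (x ≟ x) refl = refl

isLeafLabel-node-minmaxF-∷ : ∀ x l k y ys → isLeafLabel x (node l x (minmaxF (suc k) (y ∷ ys))) ≡ false
isLeafLabel-node-minmaxF-∷ x l k y ys with splitAt₂ (minW y ys) (maxW y ys) y ys
isLeafLabel-node-minmaxF-∷ x empty        k y ys | _ rewrite dec-true (x ≟ x) refl = refl
isLeafLabel-node-minmaxF-∷ x (node _ _ _) k y ys | _ rewrite dec-true (x ≟ x) refl = refl

isLeafLabel-∉ : ∀ k {w x} → x ∉ w → isLeafLabel x (minmaxF k w) ≡ false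
isLeafLabel-∉ zero    {[]}    _ = refl
isLeafLabel-∉ zero    {_ ∷ _} _ = refl
isLeafLabel-∉ (suc k) {w} {x} x∉w with firstHit (isExtreme w) w
... | none nw rewrite nonExtreme⇒[] nw = refl
... | hit Q m R refl nQ hm = begin
  isLeafLabel x (minmaxF (suc k) (Q ++ m ∷ R))
    ≡⟨ cong (isLeafLabel x) (minmaxF-root k (rootSplit refl nQ hm)) ⟩
  isLeafLabel x (node (minmaxF k Q) m (minmaxF k R))
    ≡⟨ isLeafLabel-node-≢ _ _ (λ x≡m → x∉w (∈-++⁺ʳ Q (here x≡m))) ⟩
  isLeafLabel x (minmaxF k Q) ∨ isLeafLabel x (minmaxF k R)
    ≡⟨ cong₂ _∨_ (isLeafLabel-∉ k {Q} (x∉w ∘ ∈-++⁺ˡ)) (isLeafLabel-∉ k (x∉w ∘ ∈-++⁺ʳ Q ∘ there)) ⟩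
  false
    ∎
  where open ≡-Reasoning

Unique-++⁻ : ∀ xs {ys : List ℕ} → Unique (xs ++ ys) → Unique xs × Unique ys × Disjoint xs ys
Unique-++⁻ []       u             = [] , u , λ ()
Unique-++⁻ (x ∷ xs) (x∉xsys ∷ u) with Unique-++⁻ xs u
... | uxs , uys , disjoint = All.++⁻ˡ xs x∉xsys ∷ uxs , uys , λ
  { (here refl  , v∈ys) → All.lookup (All.++⁻ʳ xs x∉xsys) v∈ys refl
  ; (there v∈xs , v∈ys) → disjoint (v∈xs , v∈ys) }

Distinct≤ : ℕ → List ℕ → Set
Distinct≤ k w = Unique w × length w ≤ k

Distinct≤-resp-↭ : ∀ {k w w′} → w ↭ w′ → Distinct≤ k w → Distinct≤ k w′
Distinct≤-resp-↭ σ (u , le) = ↭ₛ.Unique-resp-↭ (setoid ℕ) (↭⇒↭ₛ σ) u , subst (_≤ _) (↭-length σ) le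

Distinct≤-parts : ∀ {k w} Q m R → w ≡ Q ++ m ∷ R → Distinct≤ (suc k) w → Distinct≤ k Q × Distinct≤ k R
Distinct≤-parts Q m R refl (u , le) with Unique-++⁻ Q u
... | uQ , (_ ∷ uR) , _ = (uQ , m+n≤o⇒m≤o (length Q) bound) , (uR , m+n≤o⇒n≤o (length Q) bound)
  where
  bound : length Q + length R ≤ _
  bound = ≤-pred (subst (_≤ _) (trans (length-++-sucʳ Q m R) (cong suc (length-++ Q))) le)

isLeafLabel-descendʳ : ∀ k {w Q m R x} → RootSplit w Q m R → Unique w → x ∈ R →
                       isLeafLabel x (minmaxF (suc k) w) ≡ isLeafLabel x (minmaxF k R)
isLeafLabel-descendʳ k {Q = Q} {m} {R} {x} root@(rootSplit refl _ _) u x∈R with Unique-++⁻ Q u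
... | _ , (m∉R ∷ _) , disjoint = begin
  isLeafLabel x (minmaxF (suc k) (Q ++ m ∷ R))
    ≡⟨ cong (isLeafLabel x) (minmaxF-root k root) ⟩
  isLeafLabel x (node (minmaxF k Q) m (minmaxF k R))
    ≡⟨ isLeafLabel-node-≢ _ _ (λ x≡m → All.lookup m∉R x∈R (sym x≡m)) ⟩
  isLeafLabel x (minmaxF k Q) ∨ isLeafLabel x (minmaxF k R)
    ≡⟨ cong (_∨ _) (isLeafLabel-∉ k (λ x∈Q → disjoint (x∈Q , there x∈R))) ⟩
  isLeafLabel x (minmaxF k R)
    ∎
  where open ≡-Reasoning

isLeafLabel-descendˡ : ∀ k {w Q m R x} → RootSplit w Q m R → Unique w → x ∈ Q →
                       isLeafLabel x (minmaxF (suc k) w) ≡ isLeafLabel x (minmaxF k Q)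
isLeafLabel-descendˡ k {Q = Q} {m} {R} {x} root@(rootSplit refl _ _) u x∈Q with Unique-++⁻ Q u
... | _ , _ , disjoint = begin
  isLeafLabel x (minmaxF (suc k) (Q ++ m ∷ R))
    ≡⟨ cong (isLeafLabel x) (minmaxF-root k root) ⟩
  isLeafLabel x (node (minmaxF k Q) m (minmaxF k R))
    ≡⟨ isLeafLabel-node-≢ _ _ (λ x≡m → disjoint (x∈Q , here x≡m)) ⟩
  isLeafLabel x (minmaxF k Q) ∨ isLeafLabel x (minmaxF k R)
    ≡⟨ cong (_ ∨_) (isLeafLabel-∉ k (λ x∈R → disjoint (x∈Q , there x∈R))) ⟩
  isLeafLabel x (minmaxF k Q) ∨ false
    ≡⟨ ∨-identityʳ _ ⟩
  isLeafLabel x (minmaxF k Q)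
    ∎
  where open ≡-Reasoning

isLeafLabel-root-∷ : ∀ k {w Q m y ys} → RootSplit w Q m (y ∷ ys) → 1 ≤ k →
                     isLeafLabel m (minmaxF (suc k) w) ≡ false
isLeafLabel-root-∷ (suc k) {Q = Q} {m} {y} {ys} root _ =
  trans (cong (isLeafLabel m) (minmaxF-root (suc k) root)) (isLeafLabel-node-minmaxF-∷ m (minmaxF (suc k) Q) k y ys)

¬Distinct≤0 : ∀ Q m R → ¬ Distinct≤ 0 (Q ++ m ∷ R)
¬Distinct≤0 Q m R (_ , le) = contradiction (subst (_≤ 0) (length-++-sucʳ Q m R) le) λ ()

isLeafLabel-last : ∀ k Q z → Distinct≤ k (Q ++ z ∷ []) → isLeafLabel z (minmaxF k (Q ++ z ∷ [])) ≡ true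
isLeafLabel-last zero    Q z d = contradiction d (¬Distinct≤0 Q z [])
isLeafLabel-last (suc k) Q z d with firstHit (isExtreme (Q ++ z ∷ [])) Q
... | hit Q₁ m Q₂ refl nQ₁ hm =
  trans (isLeafLabel-descendʳ k root (proj₁ d) (∈-++⁺ʳ Q₂ (here refl)))
        (isLeafLabel-last k Q₂ z (proj₂ (Distinct≤-parts Q₁ m (Q₂ ++ z ∷ []) split-≡ d)))
  where root = rootSplit (++-assoc Q₁ (m ∷ Q₂) (z ∷ [])) nQ₁ hm
        open RootSplit root
... | none nQ with refl ← nonExtreme-init⇒[] Q z refl nQ =
  trans (cong (isLeafLabel z) (minmaxF-root k (rootSplit refl [] (isExtreme-minOf (z ∷ [])))))
        (isLeafLabel-singleton z)

isLeafLabel-secondLast : ∀ k Q x y → Distinct≤ k (Q ++ x ∷ y ∷ []) →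
                         isLeafLabel x (minmaxF k (Q ++ x ∷ y ∷ [])) ≡ false
isLeafLabel-secondLast zero    Q x y d = contradiction d (¬Distinct≤0 Q x (y ∷ []))
isLeafLabel-secondLast (suc k) Q x y d with firstHit (isExtreme (Q ++ x ∷ y ∷ [])) Q
... | hit Q₁ m Q₂ refl nQ₁ hm =
  trans (isLeafLabel-descendʳ k root (proj₁ d) (∈-++⁺ʳ Q₂ (here refl)))
        (isLeafLabel-secondLast k Q₂ x y (proj₂ (Distinct≤-parts Q₁ m (Q₂ ++ x ∷ y ∷ []) split-≡ d)))
  where root = rootSplit (++-assoc Q₁ (m ∷ Q₂) (x ∷ y ∷ [])) nQ₁ hm
        open RootSplit root
... | none nQ with isExtreme (Q ++ x ∷ y ∷ []) x in ex
...   | true  = isLeafLabel-root-∷ k root (proj₂ (proj₂ (Distinct≤-parts Q x (y ∷ []) refl d)))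
  where root = rootSplit refl nQ ex
...   | false = contradiction Q++x≡[] (λ Q++x≡[] → contradiction (++-conicalʳ Q (x ∷ []) Q++x≡[]) λ ())
  where
  Q++x≡[] : Q ++ x ∷ [] ≡ []
  Q++x≡[] = nonExtreme-init⇒[] (Q ++ x ∷ []) y (sym (++-assoc Q (x ∷ []) (y ∷ []))) (All.++⁺ nQ (ex ∷ []))

-- A block of three consecutive entries

isLeafLabel-blockRoot : ∀ k P x y z S → let w = P ++ x ∷ y ∷ z ∷ S in
                        Distinct≤ (suc k) w → NonExtreme w P → Any (λ q → isExtreme w q ≡ true) (x ∷ y ∷ z ∷ []) →
                        isLeafLabel x (minmaxF (suc k) w) ≡ not (isExtreme w x) ∧ isExtreme w y
isLeafLabel-blockRoot k P x y z S d nP someExtreme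
  with isExtreme (P ++ x ∷ y ∷ z ∷ S) x in ex | isExtreme (P ++ x ∷ y ∷ z ∷ S) y in ey
... | true  | _    =
  isLeafLabel-root-∷ k (rootSplit refl nP ex) (≤-trans (s≤s z≤n) (proj₂ (proj₂ (Distinct≤-parts P x (y ∷ z ∷ S) refl d))))
... | false | true =
  trans (isLeafLabel-descendˡ k root (proj₁ d) (∈-++⁺ʳ P (here refl)))
        (isLeafLabel-last k P x (proj₁ (Distinct≤-parts (P ++ x ∷ []) y (z ∷ S) split-≡ d)))
  where root = rootSplit (sym (++-assoc P (x ∷ []) (y ∷ z ∷ S))) (All.++⁺ nP (ex ∷ [])) ey
        open RootSplit root
... | false | false =
  trans (isLeafLabel-descendˡ k root (proj₁ d) (∈-++⁺ʳ P (here refl)))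
        (isLeafLabel-secondLast k P x y (proj₁ (Distinct≤-parts (P ++ x ∷ y ∷ []) z S split-≡ d)))
  where
  w = P ++ x ∷ y ∷ z ∷ S
  thirdExtreme : Any (λ q → isExtreme w q ≡ true) (x ∷ y ∷ z ∷ []) → isExtreme w z ≡ true
  thirdExtreme (here e)                 = contradiction (trans (sym e) ex) λ ()
  thirdExtreme (there (here e))         = contradiction (trans (sym e) ey) λ ()
  thirdExtreme (there (there (here e))) = e
  root = rootSplit (sym (++-assoc P (x ∷ y ∷ []) (z ∷ S))) (All.++⁺ nP (ex ∷ ey ∷ [])) (thirdExtreme someExtreme)
  open RootSplit root

nonExtreme-resp-↭ : ∀ {w w′ Q} → w ↭ w′ → NonExtreme w Q → NonExtreme w′ Q
nonExtreme-resp-↭ σ = All.map (λ {q} e → trans (sym (isExtreme-resp-↭ σ q)) e)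

rootSplit-resp-↭ : ∀ {w w′ Q Q′ m R R′} → w ↭ w′ → Q ↭ Q′ → w′ ≡ Q′ ++ m ∷ R′ → RootSplit w Q m R → RootSplit w′ Q′ m R′
rootSplit-resp-↭ {m = m} σ τ eq (rootSplit _ nQ hm) =
  rootSplit eq (All-resp-↭ τ (nonExtreme-resp-↭ σ nQ)) (trans (sym (isExtreme-resp-↭ σ m)) hm)

block-↭ : ∀ (P : List ℕ) {B′ B} S → B′ ↭ B → P ++ B′ ++ S ↭ P ++ B ++ S
block-↭ P S σ = ++⁺ˡ P (++⁺ʳ S σ)

-- P′ ++ B ++ S′ is the first word in the recursion of minmaxF on P ++ B ++ S whose root lies in B.
-- Until then the recursion only compares letters of B with the extremes, so any rearrangement B′ of
-- B follows the same path.
record Localisation (k : ℕ) (P B S : List ℕ) : Set where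
  field
    fuel              : ℕ
    P′ S′             : List ℕ
    distinct          : Distinct≤ (suc fuel) (P′ ++ B ++ S′)
    prefix-nonExtreme : NonExtreme (P′ ++ B ++ S′) P′
    block-extreme     : Any (λ b → isExtreme (P′ ++ B ++ S′) b ≡ true) B
    isLeafLabel-≡     : ∀ {B′ x} → B′ ↭ B → x ∈ B′ →
                        isLeafLabel x (minmaxF k (P ++ B′ ++ S)) ≡ isLeafLabel x (minmaxF (suc fuel) (P′ ++ B′ ++ S′))

localisation-via : ∀ {k k₀ P P₀ B S S₀} →
                   (∀ {B′ x} → B′ ↭ B → x ∈ B′ →
                      isLeafLabel x (minmaxF k₀ (P₀ ++ B′ ++ S₀)) ≡ isLeafLabel x (minmaxF k (P ++ B′ ++ S))) →
                   Localisation k P B S → Localisation k₀ P₀ B S₀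
localisation-via step loc = record
  { Localisation loc hiding (isLeafLabel-≡)
  ; isLeafLabel-≡ = λ σ x∈B′ → trans (step σ x∈B′) (Localisation.isLeafLabel-≡ loc σ x∈B′) }

localise : ∀ k P B S → Distinct≤ k (P ++ B ++ S) → B ≢ [] → Localisation k P B S
localise zero    P []      S d B≢[] = contradiction refl B≢[]
localise zero    P (b ∷ B) S d _    = contradiction d (¬Distinct≤0 P b (B ++ S))
localise (suc k) P B S d B≢[]
  with firstHit (isExtreme (P ++ B ++ S)) P | firstHit (isExtreme (P ++ B ++ S)) B | firstHit (isExtreme (P ++ B ++ S)) S
... | hit P₁ m P₂ refl nP₁ hm | _ | _ =
  localisation-via (λ σ x∈B′ → isLeafLabel-descendʳ k (root′ σ) (unique′ σ) (∈-++⁺ʳ P₂ (∈-++⁺ˡ x∈B′)))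
    (localise k P₂ B S (proj₂ (Distinct≤-parts P₁ m (P₂ ++ B ++ S) (eq B) d)) B≢[])
  where
  eq : ∀ B′ → (P₁ ++ m ∷ P₂) ++ B′ ++ S ≡ P₁ ++ m ∷ (P₂ ++ B′ ++ S)
  eq B′ = ++-assoc P₁ (m ∷ P₂) (B′ ++ S)
  unique′ : ∀ {B′} → B′ ↭ B → Unique (P ++ B′ ++ S)
  unique′ σ = proj₁ (Distinct≤-resp-↭ (↭-sym (block-↭ P S σ)) d)
  root′ : ∀ {B′} → B′ ↭ B → RootSplit ((P₁ ++ m ∷ P₂) ++ B′ ++ S) P₁ m (P₂ ++ B′ ++ S)
  root′ {B′} σ = rootSplit-resp-↭ (↭-sym (block-↭ P S σ)) ↭-refl (eq B′) (rootSplit (eq B) nP₁ hm)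
... | none nP | hit B₁ b B₂ refl _ hb | _ = record
  { fuel = k ; P′ = P ; S′ = S ; distinct = d ; prefix-nonExtreme = nP
  ; block-extreme = Any.++⁺ʳ B₁ (here hb) ; isLeafLabel-≡ = λ _ _ → refl }
... | none nP | none nB | hit S₁ m S₂ refl nS₁ hm =
  localisation-via (λ σ x∈B′ → isLeafLabel-descendˡ k (root′ σ) (unique′ σ) (∈-++⁺ʳ P (∈-++⁺ˡ x∈B′)))
    (localise k P B S₁ (proj₁ (Distinct≤-parts (P ++ B ++ S₁) m S₂ (eq B) d)) B≢[])
  where
  eq : ∀ B′ → P ++ B′ ++ S₁ ++ m ∷ S₂ ≡ (P ++ B′ ++ S₁) ++ m ∷ S₂
  eq B′ = sym (trans (++-assoc P (B′ ++ S₁) (m ∷ S₂)) (cong (P ++_) (++-assoc B′ S₁ (m ∷ S₂))))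
  unique′ : ∀ {B′} → B′ ↭ B → Unique (P ++ B′ ++ S)
  unique′ σ = proj₁ (Distinct≤-resp-↭ (↭-sym (block-↭ P S σ)) d)
  root′ : ∀ {B′} → B′ ↭ B → RootSplit (P ++ B′ ++ S₁ ++ m ∷ S₂) (P ++ B′ ++ S₁) m S₂
  root′ {B′} σ = rootSplit-resp-↭ (↭-sym (block-↭ P S σ)) (↭-sym (block-↭ P S₁ σ)) (eq B′)
                   (rootSplit (eq B) (All.++⁺ nP (All.++⁺ nB nS₁)) hm)
... | none nP | none nB | none nS =
  contradiction (nonExtreme⇒[] (All.++⁺ nP (All.++⁺ nB nS))) (B≢[] ∘ ++-conicalˡ B S ∘ ++-conicalʳ P (B ++ S))

isExtreme-notAll₃ : ∀ w {a b c} → Unique (a ∷ b ∷ c ∷ []) →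
                    isExtreme w a ≡ true → isExtreme w b ≡ true → isExtreme w c ≡ true → ⊥
isExtreme-notAll₃ w ((a≢b ∷ a≢c ∷ []) ∷ (b≢c ∷ []) ∷ [] ∷ []) ea eb ec
  with isExtreme⇒ w _ ea | isExtreme⇒ w _ eb | isExtreme⇒ w _ ec
... | inj₁ p | inj₁ q | _      = a≢b (trans p (sym q))
... | inj₂ p | inj₂ q | _      = a≢b (trans p (sym q))
... | inj₁ p | inj₂ _ | inj₁ r = a≢c (trans p (sym r))
... | inj₂ p | inj₁ _ | inj₂ r = a≢c (trans p (sym r))
... | inj₁ _ | inj₂ q | inj₂ r = b≢c (trans q (sym r))
... | inj₂ _ | inj₁ q | inj₁ r = b≢c (trans q (sym r))

data ExactlyOne : Bool → Bool → Bool → Set where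
  first  : ExactlyOne true  false false
  second : ExactlyOne false true  false
  third  : ExactlyOne false false true

exactlyOne-rotations : ∀ {A B C} → Any (_≡ true) (A ∷ B ∷ C ∷ []) → ¬ (A ≡ true × B ≡ true × C ≡ true) →
                       ExactlyOne (not A ∧ B) (not C ∧ A) (not B ∧ C)
exactlyOne-rotations {true}  {true}  {true}  _ notAll = contradiction (refl , refl , refl) notAll
exactlyOne-rotations {true}  {true}  {false} _ _      = second
exactlyOne-rotations {true}  {false} {true}  _ _      = third
exactlyOne-rotations {true}  {false} {false} _ _      = second
exactlyOne-rotations {false} {true}  {true}  _ _      = first
exactlyOne-rotations {false} {true}  {false} _ _      = first
exactlyOne-rotations {false} {false} {true}  _ _      = third
exactlyOne-rotations {false} {false} {false} (there (there (there ()))) _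

rotate₃-↭ : ∀ {a b c : ℕ} → c ∷ a ∷ b ∷ [] ↭ a ∷ b ∷ c ∷ []
rotate₃-↭ = ↭-trans (↭-swap _ _ ↭-refl) (↭-prep _ (↭-swap _ _ ↭-refl))

isLeafLabel-rotations : ∀ P a b c S → Unique (P ++ a ∷ b ∷ c ∷ S) →
                      ExactlyOne (isLeafLabel a (minmaxTree (P ++ a ∷ b ∷ c ∷ S)))
                                 (isLeafLabel c (minmaxTree (P ++ c ∷ a ∷ b ∷ S)))
                                 (isLeafLabel b (minmaxTree (P ++ b ∷ c ∷ a ∷ S)))
isLeafLabel-rotations P a b c S u = rotations
  where
  k = length (P ++ a ∷ b ∷ c ∷ S)
  open Localisation (localise k P (a ∷ b ∷ c ∷ []) S (u , ≤-refl) λ ())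
  w′ = P′ ++ a ∷ b ∷ c ∷ S′
  abc-unique : Unique (a ∷ b ∷ c ∷ [])
  abc-unique = proj₁ (Unique-++⁻ (a ∷ b ∷ c ∷ []) (proj₁ (proj₂ (Unique-++⁻ P′ (proj₁ distinct)))))
  leafOf : ∀ {x y z} → x ∷ y ∷ z ∷ [] ↭ a ∷ b ∷ c ∷ [] →
           isLeafLabel x (minmaxTree (P ++ x ∷ y ∷ z ∷ S)) ≡ not (isExtreme w′ x) ∧ isExtreme w′ y
  leafOf {x} {y} {z} σ = begin
    isLeafLabel x (minmaxTree (P ++ x ∷ y ∷ z ∷ S))
      ≡⟨ cong (λ k′ → isLeafLabel x (minmaxF k′ (P ++ x ∷ y ∷ z ∷ S))) (↭-length (block-↭ P S σ)) ⟩
    isLeafLabel x (minmaxF k (P ++ x ∷ y ∷ z ∷ S))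
      ≡⟨ isLeafLabel-≡ σ (here refl) ⟩
    isLeafLabel x (minmaxF (suc fuel) w″)
      ≡⟨ isLeafLabel-blockRoot fuel P′ x y z S′ (Distinct≤-resp-↭ τ distinct)
                                 (nonExtreme-resp-↭ τ prefix-nonExtreme) someExtreme ⟩
    not (isExtreme w″ x) ∧ isExtreme w″ y
      ≡⟨ cong₂ (λ s t → not s ∧ t) (sym (isExtreme-resp-↭ τ x)) (sym (isExtreme-resp-↭ τ y)) ⟩
    not (isExtreme w′ x) ∧ isExtreme w′ y
      ∎
    where
    open ≡-Reasoning
    w″ = P′ ++ x ∷ y ∷ z ∷ S′
    τ : w′ ↭ w″
    τ = ↭-sym (block-↭ P′ S′ σ)
    someExtreme : Any (λ q → isExtreme w″ q ≡ true) (x ∷ y ∷ z ∷ [])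
    someExtreme = Any.map (λ {q} e → trans (sym (isExtreme-resp-↭ τ q)) e) (Any-resp-↭ (↭-sym σ) block-extreme)
  rotations : ExactlyOne (isLeafLabel a (minmaxTree (P ++ a ∷ b ∷ c ∷ S)))
                         (isLeafLabel c (minmaxTree (P ++ c ∷ a ∷ b ∷ S)))
                         (isLeafLabel b (minmaxTree (P ++ b ∷ c ∷ a ∷ S)))
  rotations rewrite leafOf ↭-refl | leafOf rotate₃-↭ | leafOf (↭-trans rotate₃-↭ rotate₃-↭) =
    exactlyOne-rotations (Any.map⁺ block-extreme) (λ (ea , eb , ec) → isExtreme-notAll₃ w′ abc-unique ea eb ec)

-- Counting permutations

unique-set⇒↭ : ∀ {xs ys : List (List ℕ)} → Unique xs → Unique ys → (∀ {v} → v ∈ xs ⇔ v ∈ ys) → xs ↭ ys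
unique-set⇒↭ uxs uys xs≐ys = ∼bag⇒↭ (unique∧set⇒bag uxs uys xs≐ys)

wordsOver : List ℕ → ℕ → List (List ℕ)
wordsOver A zero    = [] ∷ []
wordsOver A (suc k) = cartesianProductWith _∷_ A (wordsOver A k)

concatMap-map≡cartesianProductWith : ∀ {A B C : Set} (f : A → B → C) xs ys →
                                     concatMap (λ x → map (f x) ys) xs ≡ cartesianProductWith f xs ys
concatMap-map≡cartesianProductWith f []       ys = refl
concatMap-map≡cartesianProductWith f (x ∷ xs) ys = cong (map (f x) ys ++_) (concatMap-map≡cartesianProductWith f xs ys)

words≡wordsOver : ∀ n k → words n k ≡ wordsOver (applyUpTo suc n) k
words≡wordsOver n zero    = refl
words≡wordsOver n (suc k) rewrite words≡wordsOver n k =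
  concatMap-map≡cartesianProductWith _∷_ (applyUpTo suc n) (wordsOver (applyUpTo suc n) k)

∈-wordsOver⁺ : ∀ {A k w} → length w ≡ k → All (_∈ A) w → w ∈ wordsOver A k
∈-wordsOver⁺ refl []           = here refl
∈-wordsOver⁺ refl (x∈A ∷ w⊆A) = ∈-cartesianProductWith⁺ _∷_ x∈A (∈-wordsOver⁺ refl w⊆A)

∈-wordsOver⁻ : ∀ A k {w} → w ∈ wordsOver A k → length w ≡ k × All (_∈ A) w
∈-wordsOver⁻ A zero    (here refl) = refl , []
∈-wordsOver⁻ A (suc k) w∈          with ∈-cartesianProductWith⁻ _∷_ A (wordsOver A k) w∈
... | x , v , x∈A , v∈ , refl = Product.map (cong suc) (x∈A ∷_) (∈-wordsOver⁻ A k v∈)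

wordsOver-unique : ∀ {A} k → Unique A → Unique (wordsOver A k)
wordsOver-unique zero    _  = [] ∷ []
wordsOver-unique (suc k) uA = Unique.cartesianProductWith⁺ _∷_ ∷-injective uA (wordsOver-unique k uA)

arrangements : List ℕ → ℕ → List (List ℕ)
arrangements A k = filter unique? (wordsOver A k)

arrangements-unique : ∀ {A} k → Unique A → Unique (arrangements A k)
arrangements-unique k uA = Unique.filter⁺ unique? (wordsOver-unique k uA)

_∖_ : List ℕ → ℕ → List ℕ
A ∖ y = filter (λ x → ¬? (x ≟ y)) A

∈-∖⁺ : ∀ {A x y} → x ∈ A → x ≢ y → x ∈ A ∖ y
∈-∖⁺ {y = y} = ∈-filter⁺ (λ x → ¬? (x ≟ y))

∈-∖⁻ : ∀ {A x y} → x ∈ A ∖ y → x ∈ A × x ≢ y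
∈-∖⁻ {A} {y = y} = ∈-filter⁻ (λ x → ¬? (x ≟ y)) {xs = A}

∖-unique : ∀ {A} y → Unique A → Unique (A ∖ y)
∖-unique y = Unique.filter⁺ (λ x → ¬? (x ≟ y))

length-∖ : ∀ {A y} → Unique A → y ∈ A → suc (length (A ∖ y)) ≡ length A
length-∖ {y ∷ A} {y} (y∉A ∷ _) (here refl)
  rewrite filter-reject (λ x → ¬? (x ≟ y)) {x = y} {xs = A} (λ y≢y → y≢y refl)
        | filter-all (λ x → ¬? (x ≟ y)) (All.map (λ y≢x → y≢x ∘ sym) y∉A) = refl
length-∖ {x ∷ A} {y} (x∉A ∷ uA) (there y∈A)
  rewrite filter-accept (λ x → ¬? (x ≟ y)) {x = x} {xs = A} (λ x≡y → All.lookup x∉A y∈A x≡y) = cong suc (length-∖ uA y∈A)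

arrangements-headed : ∀ {A} k y → Unique A →
                      filter unique? (map (y ∷_) (wordsOver A k)) ↭ map (y ∷_) (arrangements (A ∖ y) k)
arrangements-headed {A} k y uA = unique-set⇒↭
  (Unique.filter⁺ unique? (Unique.map⁺ ∷-injectiveʳ (wordsOver-unique k uA)))
  (Unique.map⁺ ∷-injectiveʳ (arrangements-unique k (∖-unique y uA)))
  (mk⇔ to from)
  where
  to : ∀ {v} → v ∈ filter unique? (map (y ∷_) (wordsOver A k)) → v ∈ map (y ∷_) (arrangements (A ∖ y) k)
  to v∈ with ∈-filter⁻ unique? {xs = map (y ∷_) (wordsOver A k)} v∈
  ... | v∈map , uv with ∈-map⁻ (y ∷_) v∈map
  ...   | w , w∈ , refl with uv | ∈-wordsOver⁻ A k w∈
  ...     | y∉w ∷ uw | len , w⊆A = ∈-map⁺ (y ∷_) (∈-filter⁺ unique?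
                          (∈-wordsOver⁺ len (All.zipWith (λ (x∈A , y≢x) → ∈-∖⁺ x∈A (y≢x ∘ sym)) (w⊆A , y∉w))) uw)
  from : ∀ {v} → v ∈ map (y ∷_) (arrangements (A ∖ y) k) → v ∈ filter unique? (map (y ∷_) (wordsOver A k))
  from v∈ with ∈-map⁻ (y ∷_) v∈
  ... | w , w∈ , refl with ∈-filter⁻ unique? {xs = wordsOver (A ∖ y) k} w∈
  ...   | w∈′ , uw with ∈-wordsOver⁻ (A ∖ y) k w∈′
  ...     | len , w⊆A∖y = ∈-filter⁺ unique?
                             (∈-map⁺ (y ∷_) (∈-wordsOver⁺ len (All.map (proj₁ ∘ ∈-∖⁻ {A}) w⊆A∖y)))
                             (All.map (λ x∈ → proj₂ (∈-∖⁻ {A} x∈) ∘ sym) w⊆A∖y ∷ uw)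

length-arrangements : ∀ k {A} → Unique A → length A ≡ k → length (arrangements A k) ≡ k !
length-arrangements zero    _      _    = refl
length-arrangements (suc k) {A} uA lenA = begin
  length (filter unique? (cartesianProductWith _∷_ A W)) ≡⟨ byHead A (All.tabulate id) ⟩
  length A * k !                                         ≡⟨ cong (_* k !) lenA ⟩
  suc k !                                                ∎
  where
  open ≡-Reasoning
  W = wordsOver A k
  headed : ∀ {y} → y ∈ A → length (filter unique? (map (y ∷_) W)) ≡ k !
  headed {y} y∈A = begin
    length (filter unique? (map (y ∷_) W))         ≡⟨ ↭-length (arrangements-headed k y uA) ⟩
    length (map (y ∷_) (arrangements (A ∖ y) k))   ≡⟨ length-map (y ∷_) (arrangements (A ∖ y) k) ⟩
    length (arrangements (A ∖ y) k)                ≡⟨ length-arrangements k (∖-unique y uA)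
                                                        (suc-injective (trans (length-∖ uA y∈A) lenA)) ⟩
    k !                                            ∎
  byHead : ∀ B → All (_∈ A) B → length (filter unique? (cartesianProductWith _∷_ B W)) ≡ length B * k !
  byHead []      _           = refl
  byHead (y ∷ B) (y∈A ∷ B⊆A) = begin
    length (filter unique? (map (y ∷_) W ++ cartesianProductWith _∷_ B W))
      ≡⟨ cong length (filter-++ unique? (map (y ∷_) W) _) ⟩
    length (filter unique? (map (y ∷_) W) ++ filter unique? (cartesianProductWith _∷_ B W))
      ≡⟨ length-++ (filter unique? (map (y ∷_) W)) ⟩
    length (filter unique? (map (y ∷_) W)) + length (filter unique? (cartesianProductWith _∷_ B W))
      ≡⟨ cong₂ _+_ (headed y∈A) (byHead B B⊆A) ⟩
    k ! + length B * k !
      ∎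

∈-range⁺ : ∀ {n x} → 1 ≤ x × x ≤ n → x ∈ applyUpTo suc n
∈-range⁺ {x = suc i} (_ , i<n) = ∈-applyUpTo⁺ suc i<n

∈-range⁻ : ∀ {n x} → x ∈ applyUpTo suc n → 1 ≤ x × x ≤ n
∈-range⁻ x∈ with ∈-applyUpTo⁻ suc x∈
... | i , i<n , refl = s≤s z≤n , i<n

range-unique : ∀ n → Unique (applyUpTo suc n)
range-unique n = Unique.applyUpTo⁺₁ suc n (λ i<j _ → <⇒≢ i<j ∘ suc-injective)

IsPerm⇔arrangement : ∀ {n p} → IsPerm n p ⇔ p ∈ arrangements (applyUpTo suc n) n
IsPerm⇔arrangement {n} {p} = mk⇔
  (λ (len , bounded , u) → ∈-filter⁺ unique? (∈-wordsOver⁺ len (All.map ∈-range⁺ bounded)) u)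
  (λ p∈ → let p∈W , u = ∈-filter⁻ unique? {xs = wordsOver (applyUpTo suc n) n} p∈
              len , p⊆ = ∈-wordsOver⁻ _ n p∈W
          in len , All.map ∈-range⁻ p⊆ , u)

∈-perms⇔ : ∀ {n p} → p ∈ perms n ⇔ IsPerm n p
∈-perms⇔ {n} {p} = mk⇔
  (proj₂ ∘ ∈-filter⁻ (isPerm? n) {xs = words n n})
  (λ ip → ∈-filter⁺ (isPerm? n)
            (subst (p ∈_) (sym (words≡wordsOver n n)) (proj₁ (∈-filter⁻ unique? (Equivalence.to IsPerm⇔arrangement ip))))
            ip)

perms-unique : ∀ n → Unique (perms n)
perms-unique n = Unique.filter⁺ (isPerm? n) (subst Unique (sym (words≡wordsOver n n)) (wordsOver-unique n (range-unique n)))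

length-perms : ∀ n → length (perms n) ≡ n !
length-perms n = begin
  length (perms n)
    ≡⟨ ↭-length (unique-set⇒↭ (perms-unique n) (arrangements-unique n (range-unique n))
                              (⇔-trans (∈-perms⇔ {n}) (IsPerm⇔arrangement {n}))) ⟩
  length (arrangements (applyUpTo suc n) n)
    ≡⟨ length-arrangements n (range-unique n) (length-applyUpTo suc n) ⟩
  n !
    ∎
  where open ≡-Reasoning

IsPerm-resp-↭ : ∀ {n p q} → p ↭ q → IsPerm n p → IsPerm n q
IsPerm-resp-↭ σ (len , bounded , u) =
  trans (sym (↭-length σ)) len , All-resp-↭ σ bounded , ↭ₛ.Unique-resp-↭ (setoid ℕ) (↭⇒↭ₛ σ) u

rotate : ℕ → List ℕ → List ℕ
rotate zero    (a ∷ b ∷ c ∷ S) = c ∷ a ∷ b ∷ S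
rotate zero    p               = p
rotate (suc j) []              = []
rotate (suc j) (x ∷ p)         = x ∷ rotate j p

rotate-++ : ∀ P a b c S → rotate (length P) (P ++ a ∷ b ∷ c ∷ S) ≡ P ++ c ∷ a ∷ b ∷ S
rotate-++ []      a b c S = refl
rotate-++ (x ∷ P) a b c S = cong (x ∷_) (rotate-++ P a b c S)

rotate-↭ : ∀ j p → rotate j p ↭ p
rotate-↭ zero    []              = ↭-refl
rotate-↭ zero    (a ∷ [])        = ↭-refl
rotate-↭ zero    (a ∷ b ∷ [])    = ↭-refl
rotate-↭ zero    (a ∷ b ∷ c ∷ S) = ++⁺ʳ S rotate₃-↭
rotate-↭ (suc j) []              = ↭-refl
rotate-↭ (suc j) (x ∷ p)         = ↭-prep x (rotate-↭ j p)

rotate³ : ∀ j p → rotate j (rotate j (rotate j p)) ≡ p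
rotate³ zero    []              = refl
rotate³ zero    (a ∷ [])        = refl
rotate³ zero    (a ∷ b ∷ [])    = refl
rotate³ zero    (a ∷ b ∷ c ∷ S) = refl
rotate³ (suc j) []              = refl
rotate³ (suc j) (x ∷ p)         = cong (x ∷_) (rotate³ j p)

map-rotate-perms : ∀ n j → map (rotate j) (perms n) ↭ perms n
map-rotate-perms n j = unique-set⇒↭ (Unique.map⁺ rotate-injective (perms-unique n)) (perms-unique n) (mk⇔ to from)
  where
  ρ = rotate j
  rotate-injective : ∀ {p q} → ρ p ≡ ρ q → p ≡ q
  rotate-injective {p} {q} ρp≡ρq = trans (sym (rotate³ j p)) (trans (cong (ρ ∘ ρ) ρp≡ρq) (rotate³ j q))
  ρ-perm : ∀ {p} → p ∈ perms n → ρ p ∈ perms n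
  ρ-perm {p} p∈ =
    Equivalence.from (∈-perms⇔ {n}) (IsPerm-resp-↭ (↭-sym (rotate-↭ j p)) (Equivalence.to (∈-perms⇔ {n}) p∈))
  to : ∀ {v} → v ∈ map ρ (perms n) → v ∈ perms n
  to v∈ with ∈-map⁻ ρ v∈
  ... | p , p∈ , refl = ρ-perm p∈
  from : ∀ {v} → v ∈ perms n → v ∈ map ρ (perms n)
  from {v} v∈ = subst (_∈ map ρ (perms n)) (rotate³ j v) (∈-map⁺ ρ (ρ-perm (ρ-perm v∈)))

filterᵇ-map : ∀ {A : Set} (f : A → Bool) (ρ : A → A) xs → filterᵇ f (map ρ xs) ≡ map ρ (filterᵇ (f ∘ ρ) xs)
filterᵇ-map f ρ []       = refl
filterᵇ-map f ρ (x ∷ xs) with f (ρ x)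
... | true  = cong (ρ x ∷_) (filterᵇ-map f ρ xs)
... | false = filterᵇ-map f ρ xs

length-filterᵇ-∘-permuting : ∀ {A : Set} (f : A → Bool) ρ L → map ρ L ↭ L →
                             length (filterᵇ (f ∘ ρ) L) ≡ length (filterᵇ f L)
length-filterᵇ-∘-permuting f ρ L σ = begin
  length (filterᵇ (f ∘ ρ) L)          ≡⟨ length-map ρ (filterᵇ (f ∘ ρ) L) ⟨
  length (map ρ (filterᵇ (f ∘ ρ) L))  ≡⟨ cong length (filterᵇ-map f ρ L) ⟨
  length (filterᵇ f (map ρ L))        ≡⟨ ↭-length (filter-↭ (T? ∘ f) σ) ⟩
  length (filterᵇ f L)                ∎
  where open ≡-Reasoning

length-filterᵇ-exactlyOne : ∀ {A : Set} (f g h : A → Bool) L → All (λ p → ExactlyOne (f p) (g p) (h p)) L →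
                            length (filterᵇ f L) + length (filterᵇ g L) + length (filterᵇ h L) ≡ length L
length-filterᵇ-exactlyOne f g h []      []       = refl
length-filterᵇ-exactlyOne f g h (x ∷ L) (e ∷ es) with f x | g x | h x | e
... | true  | false | false | first  = cong suc (length-filterᵇ-exactlyOne f g h L es)
... | false | true  | false | second
  rewrite +-suc (length (filterᵇ f L)) (length (filterᵇ g L)) = cong suc (length-filterᵇ-exactlyOne f g h L es)
... | false | false | true  | third
  rewrite +-suc (length (filterᵇ f L) + length (filterᵇ g L)) (length (filterᵇ h L)) =
  cong suc (length-filterᵇ-exactlyOne f g h L es)

data Block (j : ℕ) : List ℕ → Set where
  block : ∀ P a b c S → length P ≡ j → Block j (P ++ a ∷ b ∷ c ∷ S)

block? : ∀ j p → 3 + j ≤ length p → Block j p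
block? zero    (a ∷ b ∷ c ∷ S) _                = block [] a b c S refl
block? zero    (a ∷ [])        (s≤s ())
block? zero    (a ∷ b ∷ [])    (s≤s (s≤s ()))
block? (suc j) (x ∷ p)         (s≤s le) with block? j p le
... | block P a b c S refl = block (x ∷ P) a b c S refl

entry-++ : ∀ P a R → entry (P ++ a ∷ R) (suc (length P)) ≡ just a
entry-++ []      a R = refl
entry-++ (x ∷ P) a R = entry-++ P a R

isLeafAt-++ : ∀ P a R → isLeafAt (P ++ a ∷ R) (suc (length P)) ≡ isLeafLabel a (minmaxTree (P ++ a ∷ R))
isLeafAt-++ P a R rewrite entry-++ P a R = refl

rotations-exactlyOne : ∀ j p → Unique p → 3 + j ≤ length p →
                       ExactlyOne (isLeafAt p (suc j)) (isLeafAt (rotate j p) (suc j))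
                                  (isLeafAt (rotate j (rotate j p)) (suc j))
rotations-exactlyOne j p u le with block? j p le
... | block P a b c S refl
  rewrite rotate-++ P a b c S | rotate-++ P c a b S
        | isLeafAt-++ P a (b ∷ c ∷ S) | isLeafAt-++ P c (a ∷ b ∷ S) | isLeafAt-++ P b (c ∷ a ∷ S) =
  isLeafLabel-rotations P a b c S u

length-filterᵇ-isLeafAt-interior : ∀ n j → 3 + j ≤ n → length (filterᵇ (λ p → isLeafAt p (suc j)) (perms n)) ≡ n ! / 3
length-filterᵇ-isLeafAt-interior n j le = begin
  X          ≡⟨ m*n/n≡m X 3 ⟨
  X * 3 / 3  ≡⟨ cong (_/ 3) X*3≡n! ⟩
  n ! / 3    ∎
  where
  open ≡-Reasoning
  f : List ℕ → Bool
  f p = isLeafAt p (suc j)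
  ρ = rotate j
  count : (List ℕ → Bool) → ℕ
  count g = length (filterᵇ g (perms n))
  X = count f
  count-ρ : ∀ g → count (g ∘ ρ) ≡ count g
  count-ρ g = length-filterᵇ-∘-permuting g ρ (perms n) (map-rotate-perms n j)
  exactlyOne : All (λ p → ExactlyOne (f p) (f (ρ p)) (f (ρ (ρ p)))) (perms n)
  exactlyOne = All.tabulate λ {p} p∈ → let len , _ , u = Equivalence.to (∈-perms⇔ {n}) p∈ in
    rotations-exactlyOne j p u (subst (3 + j ≤_) (sym len) le)
  X*3≡n! : X * 3 ≡ n !
  X*3≡n! = begin
    X * 3
      ≡⟨ solve 1 (λ x → x :* con 3 := x :+ x :+ x) refl X ⟩
    X + X + X
      ≡⟨ cong₂ (λ s t → X + s + t) (count-ρ f) (trans (count-ρ (f ∘ ρ)) (count-ρ f)) ⟨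
    count f + count (f ∘ ρ) + count (f ∘ ρ ∘ ρ)
      ≡⟨ length-filterᵇ-exactlyOne f (f ∘ ρ) (f ∘ ρ ∘ ρ) (perms n) exactlyOne ⟩
    length (perms n)
      ≡⟨ length-perms n ⟩
    n !
      ∎
    where open +-*-Solver

length-∷ʳ : ∀ (Q : List ℕ) z → length (Q ∷ʳ z) ≡ suc (length Q)
length-∷ʳ Q z = trans (length-++ Q) (+-comm (length Q) 1)

isLeafAt-last : ∀ p → 1 ≤ length p → Unique p → isLeafAt p (length p) ≡ true
isLeafAt-last p 1≤len u with initLast p
... | []      = contradiction 1≤len λ ()
... | Q ∷ʳ′ z = begin
  isLeafAt (Q ∷ʳ z) (length (Q ∷ʳ z))  ≡⟨ cong (isLeafAt (Q ∷ʳ z)) (length-∷ʳ Q z) ⟩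
  isLeafAt (Q ∷ʳ z) (suc (length Q))   ≡⟨ isLeafAt-++ Q z [] ⟩
  isLeafLabel z (minmaxTree (Q ∷ʳ z))  ≡⟨ isLeafLabel-last _ Q z (u , ≤-refl) ⟩
  true                                 ∎
  where open ≡-Reasoning

isLeafAt-secondLast : ∀ p → 2 ≤ length p → Unique p → isLeafAt p (length p ∸ 1) ≡ false
isLeafAt-secondLast p 2≤len u with initLast p
... | []       = contradiction 2≤len λ ()
... | Q′ ∷ʳ′ y with initLast Q′
...   | []      = contradiction 2≤len λ { (s≤s ()) }
...   | Q ∷ʳ′ x = begin
  isLeafAt ((Q ∷ʳ x) ∷ʳ y) (length ((Q ∷ʳ x) ∷ʳ y) ∸ 1)
    ≡⟨ cong₂ isLeafAt reassoc (trans (cong (_∸ 1) (length-∷ʳ (Q ∷ʳ x) y)) (length-∷ʳ Q x)) ⟩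
  isLeafAt (Q ++ x ∷ y ∷ []) (suc (length Q))
    ≡⟨ isLeafAt-++ Q x (y ∷ []) ⟩
  isLeafLabel x (minmaxTree (Q ++ x ∷ y ∷ []))
    ≡⟨ isLeafLabel-secondLast _ Q x y (subst Unique reassoc u , ≤-refl) ⟩
  false
    ∎
  where
  open ≡-Reasoning
  reassoc : (Q ∷ʳ x) ∷ʳ y ≡ Q ++ x ∷ y ∷ []
  reassoc = ++-assoc Q (x ∷ []) (y ∷ [])

interior-bound : ∀ {n j} → suc j ≤ n ∸ 2 → 3 + j ≤ n
interior-bound {suc (suc n)} j<n∸2 = s≤s (s≤s j<n∸2)

mainTheorem2 : (n : ℕ) → 3 ≤ n →
    ((i : ℕ) → 1 ≤ i → i ≤ n ∸ 2 →
      length (filterᵇ (λ p → isLeafAt p i) (perms n)) ≡ (n !) / 3)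
    × ((p : List ℕ) → IsPerm n p → isLeafAt p (n ∸ 1) ≡ false)
    × ((p : List ℕ) → IsPerm n p → isLeafAt p n ≡ true)
mainTheorem2 n 3≤n = interior , secondLast , last
  where
  interior : (i : ℕ) → 1 ≤ i → i ≤ n ∸ 2 → length (filterᵇ (λ p → isLeafAt p i) (perms n)) ≡ (n !) / 3
  interior (suc j) _ i≤n∸2 = length-filterᵇ-isLeafAt-interior n j (interior-bound i≤n∸2)
  secondLast : (p : List ℕ) → IsPerm n p → isLeafAt p (n ∸ 1) ≡ false
  secondLast p (len , _ , u) =
    subst (λ m → isLeafAt p (m ∸ 1) ≡ false) len
          (isLeafAt-secondLast p (subst (2 ≤_) (sym len) (≤-trans (s≤s (s≤s z≤n)) 3≤n)) u)
  last : (p : List ℕ) → IsPerm n p → isLeafAt p n ≡ true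
  last p (len , _ , u) =
    subst (λ m → isLeafAt p m ≡ true) len
          (isLeafAt-last p (subst (1 ≤_) (sym len) (≤-trans (s≤s z≤n) 3≤n)) u)
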